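{- Let $m\ge 2$, $1\le s\le m$, and let $(f_1,\dots,f_s)$ and $(g_1,\dots,g_s)$ be bent vectorial functions from $\mathrm{GF}(2^{2m})$ to $\mathrm{GF}(2)^s$. Then the codes $\mathcal{C}(f_1,\dots,f_s)$ and $\mathcal{C}(g_1,\dots,g_s)$ are equivalent if and only if the designs supported by their minimum-weight codewords are isomorphic.
   Context: Write $\mathrm{GF}(2^{2m})=\{u_1,\dots,u_q\}$, $q=2^{2m}$, and let $\mathrm{tr}_{2m/1}$ be the absolute trace to $\mathrm{GF}(2)$. A Boolean function $f:\mathrm{GF}(2^{2m})\to\mathrm{GF}(2)$ is bent if $\left|\sum_{x}(-1)^{f(x)+\mathrm{tr}_{2m/1}(wx)}\right|=2^m$ for all $w$. $(f_1,\dots,f_s)$ is a bent vectorial function if $\sum_j a_jf_j$ is bent for every nonzero $(a_1,\dots,a_s)\in\mathrm{GF}(2)^s$. The truth table of $f$ is $(f(u_1),\dots,f(u_q))$. $\mathrm{RM}_2(1,2m)=\{(\mathrm{tr}_{2m/1}(bu_i)+c)_{i=1}^q:b\in\mathrm{GF}(2^{2m}),c\in\mathrm{GF}(2)\}$, and $\mathcal{C}(f_1,\dots,f_s)$ is the binary linear code spanned by $\mathrm{RM}_2(1,2m)$ and the truth tables of $f_1,\dots,f_s$. The design supported by the minimum-weight codewords has the $q$ coordinate positions as points and the supports (sets of nonzero positions) of the minimum-weight codewords as blocks. Two codes are equivalent if a coordinate permutation maps one onto the other; two designs are isomorphic if a bijection between their point sets maps blocks onto blocks. -}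

module Defs where

open import Level using (0ℓ)
open import Data.Nat using (ℕ; zero; suc; _^_; _≤_)
open import Data.Bool using (Bool; true; false; _xor_; _∧_; not)
open import Data.Fin using (Fin)
open import Data.Fin.Subset using (Subset; ∣_∣)
open import Data.Fin.Permutation using (Permutation′; _⟨$⟩ʳ_)
open import Data.Vec using (Vec; tabulate; lookup; replicate)
import Data.Integer as ℤ
open ℤ using (ℤ; +_)
open import Data.Product using (Σ; ∃; ∃-syntax; _×_; _,_)
open import Relation.Binary.PropositionalEquality using (_≡_; _≢_)
open import Relation.Nullary using (Dec; yes; no; ¬_)
open import Relation.Nullary.Decidable using (⌊_⌋)
open import Function.Bundles using (_↔_; Inverse; _⇔_)
open import Algebra.Structures using (IsCommutativeRing)

record FiniteField (q : ℕ) : Set₁ where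
  field
    Carrier : Set
    _+_ _*_ : Carrier → Carrier → Carrier
    -_      : Carrier → Carrier
    0# 1#   : Carrier
    isCommutativeRing : IsCommutativeRing _≡_ _+_ _*_ -_ 0# 1#
    _⁻¹     : Carrier → Carrier
    ⁻¹-inverse : ∀ x → x ≢ 0# → x * (x ⁻¹) ≡ 1#
    0≢1     : 0# ≢ 1#
    _≟_     : (x y : Carrier) → Dec (x ≡ y)
    enum    : Fin q ↔ Carrier

  infixl 6 _+_
  infixl 7 _*_

  u : Fin q → Carrier
  u = Inverse.to enum

  pow : Carrier → ℕ → Carrier
  pow x zero    = 1#
  pow x (suc k) = x * pow x k

  traceSum : ℕ → Carrier → Carrier
  traceSum zero    x = 0#
  traceSum (suc k) x = traceSum k x + pow x (2 ^ k)

GF : ℕ → Set₁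
GF m = FiniteField (2 ^ (2 Data.Nat.* m))

module _ (m : ℕ) (F : GF m) where
  open FiniteField F

  q : ℕ
  q = 2 ^ (2 Data.Nat.* m)

  -- absolute trace tr_{2m/1}(x) = Σ_{i<2m} x^(2^i) ∈ GF(2) = {0,1},
  -- read as a Boolean (true ↔ 1).
  tr : Carrier → Bool
  tr x = not ⌊ traceSum (2 Data.Nat.* m) x ≟ 0# ⌋

  BoolFun : Set
  BoolFun = Carrier → Bool

  sign : Bool → ℤ
  sign false = + 1
  sign true  = ℤ.- (+ 1)

  Σℤ : ∀ n → (Fin n → ℤ) → ℤ
  Σℤ zero    g = + 0
  Σℤ (suc n) g = g Data.Fin.zero ℤ.+ Σℤ n (λ i → g (Data.Fin.suc i))

  walsh : BoolFun → Carrier → ℤ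
  walsh f w = Σℤ q (λ i → sign (f (u i) xor tr (w * u i)))

  IsBent : BoolFun → Set
  IsBent f = ∀ w → ℤ.∣ walsh f w ∣ ≡ 2 ^ m

  combo : ∀ {s} → (Fin s → Bool) → (Fin s → BoolFun) → BoolFun
  combo {zero}  a fs x = false
  combo {suc s} a fs x =
    (a Data.Fin.zero ∧ fs Data.Fin.zero x)
      xor combo (λ j → a (Data.Fin.suc j)) (λ j → fs (Data.Fin.suc j)) x

  IsBentVectorial : ∀ {s} → (Fin s → BoolFun) → Set
  IsBentVectorial {s} fs =
    ∀ (a : Fin s → Bool) → (¬ ∀ j → a j ≡ false) → IsBent (combo a fs)

  -- words of length q: Subset q = Vec Bool q (true = nonzero coordinate)
  Word : Set
  Word = Subset q

  truthTable : BoolFun → Word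
  truthTable f = tabulate (λ i → f (u i))

  rmWord : Carrier → Bool → Word
  rmWord b c = tabulate (λ i → tr (b * u i) xor c)

  Code : Set₁
  Code = Word → Set

  -- C(f_1,…,f_s): the GF(2)-span of RM_2(1,2m) and the truth tables of the f_j.
  -- Since RM_2(1,2m) is itself linear, the span is exactly the set of words
  -- rmWord b c + Σ_j a_j truthTable(f_j).
  C : ∀ {s} → (Fin s → BoolFun) → Code
  C fs w = ∃[ b ] ∃[ c ] ∃[ a ]
    (w ≡ tabulate (λ i → lookup (rmWord b c) i xor combo a fs (u i)))

permute : ∀ {n} → Permutation′ n → Subset n → Subset n
permute π w = tabulate (λ i → lookup w (π ⟨$⟩ʳ i))

CodesEquivalent : ∀ {n} → (Subset n → Set) → (Subset n → Set) → Set
CodesEquivalent {n} C₁ C₂ = ∃[ π ] (∀ w → C₂ w ⇔ C₁ (permute {n} π w))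

wt : ∀ {n} → Subset n → ℕ
wt w = ∣ w ∣

IsMinWeightWord : ∀ {n} → (Subset n → Set) → Subset n → Set
IsMinWeightWord {n} C w =
  C w × w ≢ replicate n false ×
  (∀ v → C v → v ≢ replicate n false → wt w ≤ wt v)

IsBlock : ∀ {n} → (Subset n → Set) → Subset n → Set
IsBlock {n} C B = ∃[ w ] (IsMinWeightWord C w × B ≡ tabulate (λ i → lookup w i))

DesignsIsomorphic : ∀ {n} → (Subset n → Set) → (Subset n → Set) → Set
DesignsIsomorphic {n} C₁ C₂ = ∃[ π ] (∀ B → IsBlock C₂ B ⇔ IsBlock C₁ (permute {n} π B))

{-# OPTIONS --safe #-}
-- Equivalent codes have isomorphic designs, since a coordinate permutation
-- preserves weights.  Conversely, a design isomorphism π matches the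
-- minimum-weight codewords of the two codes, so π is a code equivalence as soon
-- as both codes are linear and spanned by their minimum-weight codewords.
--
-- C(f₁,…,f_s) is such a code.  Since ∑ᵢ (−1)^{wᵢ} = q − 2 wt(w), weights are
-- read off signed sums: the codeword tr(bx) + c + f_a(x) has signed sum
-- ±W_{f_a}(b) = ±2^m when a ≠ 0 (f_a is bent), and 0 or −q when a = 0 and the
-- word is nonzero.  So the codewords with a ≠ 0 and signed sum +2^m have minimum
-- weight, and two of them with the same a differ by an affine word.  They also
-- give the all-one word: by the inversion formula ∑_b W_f(b) = ±q, the signs of
-- the Walsh spectrum of a bent f (its dual) are not affine in b, so for some
-- b, b′ the four minimum-weight words of f at 0, b, b′, b + b′ add up to the
-- all-one word.
module Submission where

open import Defs
open import Data.Nat using (ℕ; _≤_)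
open import Data.Fin using (Fin)
open import Function.Bundles using (_⇔_)

open import Level using (0ℓ)
open import Algebra.Bundles using (CommutativeMonoid; CommutativeRing; Semiring)
open import Algebra.Structures using (IsCommutativeRing)
import Algebra.Properties.CommutativeMonoid.Sum as MonoidSum
import Algebra.Properties.Group as GroupProperties
import Algebra.Properties.Semiring.Mult as SemiringMult
import Algebra.Properties.Semiring.Sum as SemiringSum
open import Algebra.Solver.Ring.AlmostCommutativeRing using (fromCommutativeRing)
import Algebra.Solver.Ring.NaturalCoefficients.Default as NaturalSolver
import Algebra.Solver.Ring.Simple as SimpleSolver
open import Data.Bool using (Bool; true; false; _xor_; _∧_; not; if_then_else_)
import Data.Bool.Properties as BoolP
open import Data.Empty using (⊥-elim)
import Data.Fin as Fin
open import Data.Fin.Permutation using (Permutation′; permutation; _⟨$⟩ʳ_; flip; inverseˡ; inverseʳ)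
import Data.Fin.Properties as FinP
open import Data.Fin.Subset using (Subset; ∣_∣) renaming (⊥ to ∅)
open import Data.Integer as ℤ using (ℤ; -[1+_]; 0ℤ; 1ℤ; -1ℤ)
import Data.Integer.Properties as ℤP
open import Data.Integer.Solver using (module +-*-Solver)
import Data.Nat as ℕ
open import Data.Nat using (zero; suc)
import Data.Nat.Properties as ℕP
open import Data.Product using (∃-syntax; _×_; _,_; proj₁)
open import Data.Sum using (_⊎_; inj₁; inj₂)
open import Data.Vec using ([]; _∷_; lookup; tabulate; zipWith)
open import Data.Vec.Properties
  using (zipWith-assoc; zipWith-identityˡ; zipWith-identityʳ; lookup-zipWith; lookup-replicate;
         lookup∘tabulate; tabulate∘lookup; tabulate-cong)
open import Data.Vec.Relation.Binary.Pointwise.Extensional using (ext; Pointwise-≡⇒≡)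
open import Function.Base using (_∘_)
open import Function.Bundles using (Inverse; mk⇔; Equivalence)
open import Function.Definitions using (Injective)
open import Function.Properties.Equivalence using () renaming (trans to ⇔-trans; sym to ⇔-sym)
open import Relation.Binary.PropositionalEquality
open import Relation.Nullary using (¬_; Dec; yes; no)
open import Relation.Nullary.Decidable using (⌊_⌋)

-- Words, weights and coordinate permutations

module ∑ℤ = SemiringSum ℤP.+-*-semiring
module BoolSolver = SimpleSolver (fromCommutativeRing BoolP.xor-∧-commutativeRing) Data.Bool._≟_

sgn : Bool → ℤ
sgn false = 1ℤ
sgn true  = -1ℤ

sgn-xor : ∀ x y → sgn (x xor y) ≡ sgn x ℤ.* sgn y
sgn-xor false y     = sym (ℤP.*-identityˡ (sgn y))
sgn-xor true  false = refl
sgn-xor true  true  = refl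

module _ {n : ℕ} where

  signedSum : Subset n → ℤ
  signedSum w = ∑ℤ.sum (λ i → sgn (lookup w i))

  infixr 5 _⊕_

  _⊕_ : Subset n → Subset n → Subset n
  _⊕_ = zipWith _xor_

  ≗-lookup⇒≡ : {v w : Subset n} → (∀ i → lookup v i ≡ lookup w i) → v ≡ w
  ≗-lookup⇒≡ v≗w = Pointwise-≡⇒≡ (ext v≗w)

  lookup-permute : ∀ (π : Permutation′ n) w i → lookup (permute π w) i ≡ lookup w (π ⟨$⟩ʳ i)
  lookup-permute π w i = lookup∘tabulate _ i

  permute-flip : ∀ (π : Permutation′ n) w → permute π (permute (flip π) w) ≡ w
  permute-flip π w = ≗-lookup⇒≡ λ i →
    trans (lookup-permute π (permute (flip π) w) i)
          (trans (lookup-permute (flip π) w (π ⟨$⟩ʳ i)) (cong (lookup w) (inverseˡ π)))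

  flip-permute : ∀ (π : Permutation′ n) w → permute (flip π) (permute π w) ≡ w
  flip-permute π w = ≗-lookup⇒≡ λ i →
    trans (lookup-permute (flip π) (permute π w) i)
          (trans (lookup-permute π w (flip π ⟨$⟩ʳ i)) (cong (lookup w) (inverseʳ π)))

  permute-∅ : ∀ (π : Permutation′ n) → permute π ∅ ≡ ∅
  permute-∅ π = ≗-lookup⇒≡ λ i →
    trans (lookup-permute π ∅ i) (trans (lookup-replicate (π ⟨$⟩ʳ i) false) (sym (lookup-replicate i false)))

  permute≡∅ : ∀ (π : Permutation′ n) {w} → permute π w ≡ ∅ → w ≡ ∅
  permute≡∅ π {w} πw≡∅ = begin
    w                                ≡⟨ flip-permute π w ⟨
    permute (flip π) (permute π w)   ≡⟨ cong (permute (flip π)) πw≡∅ ⟩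
    permute (flip π) ∅               ≡⟨ permute-∅ (flip π) ⟩
    ∅                                ∎
    where open ≡-Reasoning

  permute-⊕ : ∀ (π : Permutation′ n) v w → permute π (v ⊕ w) ≡ permute π v ⊕ permute π w
  permute-⊕ π v w = ≗-lookup⇒≡ λ i → begin
    lookup (permute π (v ⊕ w)) i                       ≡⟨ lookup-permute π (v ⊕ w) i ⟩
    lookup (v ⊕ w) (π ⟨$⟩ʳ i)                          ≡⟨ lookup-zipWith _xor_ (π ⟨$⟩ʳ i) v w ⟩
    lookup v (π ⟨$⟩ʳ i) xor lookup w (π ⟨$⟩ʳ i)        ≡⟨ cong₂ _xor_ (lookup-permute π v i) (lookup-permute π w i) ⟨
    lookup (permute π v) i xor lookup (permute π w) i  ≡⟨ lookup-zipWith _xor_ i (permute π v) (permute π w) ⟨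
    lookup (permute π v ⊕ permute π w) i               ∎
    where open ≡-Reasoning

  signedSum-permute : ∀ (π : Permutation′ n) w → signedSum (permute π w) ≡ signedSum w
  signedSum-permute π w = trans (∑ℤ.sum-cong-≗ (λ i → cong sgn (lookup-permute π w i)))
                                (sym (∑ℤ.sum-permute (λ i → sgn (lookup w i)) π))

signedSum+2∣w∣≡n : ∀ {n} (w : Subset n) → signedSum w ℤ.+ ((ℤ.+ ∣ w ∣) ℤ.+ (ℤ.+ ∣ w ∣)) ≡ ℤ.+ n
signedSum+2∣w∣≡n []          = refl
signedSum+2∣w∣≡n (false ∷ w) = trans (ℤP.+-assoc 1ℤ (signedSum w) _) (cong (ℤ._+_ 1ℤ) (signedSum+2∣w∣≡n w))
signedSum+2∣w∣≡n (true ∷ w)  = begin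
  (-1ℤ ℤ.+ s) ℤ.+ ((ℤ.+ suc ∣ w ∣) ℤ.+ (ℤ.+ suc ∣ w ∣))  ≡⟨ solve 2 (λ s c → (con -1ℤ :+ s) :+ ((con 1ℤ :+ c) :+ (con 1ℤ :+ c))
                                                                 := con 1ℤ :+ (s :+ (c :+ c))) refl s (ℤ.+ ∣ w ∣) ⟩
  1ℤ ℤ.+ (s ℤ.+ ((ℤ.+ ∣ w ∣) ℤ.+ (ℤ.+ ∣ w ∣)))          ≡⟨ cong (ℤ._+_ 1ℤ) (signedSum+2∣w∣≡n w) ⟩
  ℤ.+ suc _                                            ∎
  where
  open ≡-Reasoning
  open +-*-Solver
  s = signedSum w

signedSum≤⇒∣∣≥ : ∀ {n} (v w : Subset n) → signedSum v ℤ.≤ signedSum w → ∣ w ∣ ≤ ∣ v ∣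
signedSum≤⇒∣∣≥ v w sv≤sw = ℕP.≮⇒≥ λ ∣v∣<∣w∣ → ℤP.<-irrefl
  (trans (signedSum+2∣w∣≡n v) (sym (signedSum+2∣w∣≡n w)))
  (ℤP.+-mono-≤-< sv≤sw (ℤP.+-mono-< (ℤ.+<+ ∣v∣<∣w∣) (ℤ.+<+ ∣v∣<∣w∣)))

∣permute∣ : ∀ {n} (π : Permutation′ n) w → ∣ permute π w ∣ ≡ ∣ w ∣
∣permute∣ π w = ℕP.≤-antisym
  (signedSum≤⇒∣∣≥ w (permute π w) (ℤP.≤-reflexive (sym (signedSum-permute π w))))
  (signedSum≤⇒∣∣≥ (permute π w) w (ℤP.≤-reflexive (signedSum-permute π w)))

-- Codes, designs and minimum-weight words

IsMinWeightWord-permute : ∀ {n} {C₁ C₂ : Subset n → Set} (π : Permutation′ n) →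
  (∀ w → C₂ w → C₁ (permute π w)) → (∀ v → C₁ v → C₂ (permute (flip π) v)) →
  ∀ {w} → IsMinWeightWord C₂ w → IsMinWeightWord C₁ (permute π w)
IsMinWeightWord-permute π π[C₂]⊆C₁ π⁻¹[C₁]⊆C₂ {w} (w∈C₂ , w≢∅ , w-min) =
  π[C₂]⊆C₁ w w∈C₂ , (λ πw≡∅ → w≢∅ (permute≡∅ π πw≡∅)) , λ v v∈C₁ v≢∅ → begin
    ∣ permute π w ∣          ≡⟨ ∣permute∣ π w ⟩
    ∣ w ∣                    ≤⟨ w-min _ (π⁻¹[C₁]⊆C₂ v v∈C₁) (λ π⁻¹v≡∅ → v≢∅ (permute≡∅ (flip π) π⁻¹v≡∅)) ⟩
    ∣ permute (flip π) v ∣   ≡⟨ ∣permute∣ (flip π) v ⟩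
    ∣ v ∣                    ∎
  where open ℕP.≤-Reasoning

IsBlock⇔IsMinWeightWord : ∀ {n} (C : Subset n → Set) B → IsBlock C B ⇔ IsMinWeightWord C B
IsBlock⇔IsMinWeightWord C B = mk⇔
  (λ (w , w-min , B≡w) → subst (IsMinWeightWord C) (sym (trans B≡w (tabulate∘lookup w))) w-min)
  (λ B-min → B , B-min , sym (tabulate∘lookup B))

equivalent⇒isomorphic : ∀ {n} {C₁ C₂ : Subset n → Set} → CodesEquivalent C₁ C₂ → DesignsIsomorphic C₁ C₂
equivalent⇒isomorphic {C₁ = C₁} {C₂} (π , C₂⇔C₁∘π) = π , λ B →
  ⇔-trans (IsBlock⇔IsMinWeightWord C₂ B) (⇔-trans (mk⇔
    (IsMinWeightWord-permute π π[C₂]⊆C₁ π⁻¹[C₁]⊆C₂)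
    (λ πB-min → subst (IsMinWeightWord C₂) (flip-permute π B)
                  (IsMinWeightWord-permute (flip π) π⁻¹[C₁]⊆C₂ π[C₂]⊆C₁ πB-min)))
    (⇔-sym (IsBlock⇔IsMinWeightWord C₁ (permute π B))))
  where
  π[C₂]⊆C₁ : ∀ w → C₂ w → C₁ (permute π w)
  π[C₂]⊆C₁ w = Equivalence.to (C₂⇔C₁∘π w)

  π⁻¹[C₁]⊆C₂ : ∀ v → C₁ v → C₂ (permute (flip π) v)
  π⁻¹[C₁]⊆C₂ v v∈C₁ = Equivalence.from (C₂⇔C₁∘π _) (subst C₁ (sym (permute-flip π v)) v∈C₁)

record IsLinear {n} (C : Subset n → Set) : Set where
  field
    ∅∈C      : C ∅
    ⊕-closed : ∀ {v w} → C v → C w → C (v ⊕ w)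

data Span {n} (P : Subset n → Set) : Subset n → Set where
  ∅∈Span : Span P ∅
  ⊕∈Span : ∀ {v w} → P v → Span P w → Span P (v ⊕ w)

module _ {n : ℕ} {P : Subset n → Set} where

  P⊆Span : ∀ {v} → P v → Span P v
  P⊆Span {v} v∈P = subst (Span P) (zipWith-identityʳ BoolP.xor-identityʳ v) (⊕∈Span v∈P ∅∈Span)

  Span-⊕ : ∀ {v w} → Span P v → Span P w → Span P (v ⊕ w)
  Span-⊕ {w = w} ∅∈Span w∈ = subst (Span P) (sym (zipWith-identityˡ BoolP.xor-identityˡ w)) w∈
  Span-⊕ {w = w} (⊕∈Span {x} {v} x∈P v∈) w∈ =
    subst (Span P) (sym (zipWith-assoc BoolP.xor-assoc x v w)) (⊕∈Span x∈P (Span-⊕ v∈ w∈))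

  Span-permute : ∀ {P′} (π : Permutation′ n) → (∀ {v} → P v → P′ (permute π v)) →
                 ∀ {w} → Span P w → Span P′ (permute π w)
  Span-permute {P′} π π[P]⊆P′ ∅∈Span = subst (Span P′) (sym (permute-∅ π)) ∅∈Span
  Span-permute {P′} π π[P]⊆P′ (⊕∈Span {v} {w} v∈P w∈) =
    subst (Span P′) (sym (permute-⊕ π v w)) (⊕∈Span (π[P]⊆P′ v∈P) (Span-permute π π[P]⊆P′ w∈))

  Span⊆ : ∀ {C} → IsLinear C → (∀ {v} → P v → C v) → ∀ {w} → Span P w → C w
  Span⊆ C-linear P⊆C ∅∈Span           = IsLinear.∅∈C C-linear
  Span⊆ C-linear P⊆C (⊕∈Span v∈P w∈) = IsLinear.⊕-closed C-linear (P⊆C v∈P) (Span⊆ C-linear P⊆C w∈)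

SpannedByMinWeightWords : ∀ {n} → (Subset n → Set) → Set
SpannedByMinWeightWords C = ∀ {w} → C w → Span (IsMinWeightWord C) w

isomorphic⇒equivalent : ∀ {n} {C₁ C₂ : Subset n → Set} → IsLinear C₁ → IsLinear C₂ →
  SpannedByMinWeightWords C₁ → SpannedByMinWeightWords C₂ →
  DesignsIsomorphic C₁ C₂ → CodesEquivalent C₁ C₂
isomorphic⇒equivalent {C₁ = C₁} {C₂} C₁-linear C₂-linear C₁-spanned C₂-spanned (π , B₂⇔πB₁) = π , λ w → mk⇔
  (λ w∈C₂ → Span⊆ {P = IsMinWeightWord C₁} C₁-linear proj₁ (Span-permute π π[min₂]⊆min₁ (C₂-spanned w∈C₂)))
  (λ πw∈C₁ → subst C₂ (flip-permute π w)
     (Span⊆ {P = IsMinWeightWord C₂} C₂-linear proj₁ (Span-permute (flip π) π⁻¹[min₁]⊆min₂ (C₁-spanned πw∈C₁))))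
  where
  min₂⇔πmin₁ : ∀ B → IsMinWeightWord C₂ B ⇔ IsMinWeightWord C₁ (permute π B)
  min₂⇔πmin₁ B = ⇔-trans (⇔-sym (IsBlock⇔IsMinWeightWord C₂ B))
                   (⇔-trans (B₂⇔πB₁ B) (IsBlock⇔IsMinWeightWord C₁ (permute π B)))

  π[min₂]⊆min₁ : ∀ {B} → IsMinWeightWord C₂ B → IsMinWeightWord C₁ (permute π B)
  π[min₂]⊆min₁ {B} = Equivalence.to (min₂⇔πmin₁ B)

  π⁻¹[min₁]⊆min₂ : ∀ {B} → IsMinWeightWord C₁ B → IsMinWeightWord C₂ (permute (flip π) B)
  π⁻¹[min₁]⊆min₂ {B} B-min = Equivalence.from (min₂⇔πmin₁ (permute (flip π) B))
                               (subst (IsMinWeightWord C₁) (sym (permute-flip π B)) B-min)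

-- Finite fields

module FiniteSums (M : CommutativeMonoid 0ℓ 0ℓ) where
  open CommutativeMonoid M using (_≈_; ε; ∙-cong; identityˡ; identityʳ)
    renaming (Carrier to A; refl to ≈-refl; trans to ≈-trans)
  open MonoidSum M using (sum)

  sum-ε : ∀ {n} (f : Fin n → A) → (∀ i → f i ≈ ε) → sum f ≈ ε
  sum-ε {zero}  f f≈ε = ≈-refl
  sum-ε {suc n} f f≈ε = ≈-trans (∙-cong (f≈ε Fin.zero) (sum-ε (f ∘ Fin.suc) (f≈ε ∘ Fin.suc))) (identityˡ ε)

  sum-δ : ∀ {n} (f : Fin n → A) j → (∀ i → i ≢ j → f i ≈ ε) → sum f ≈ f j
  sum-δ {suc n} f Fin.zero f≈ε =
    ≈-trans (∙-cong ≈-refl (sum-ε (f ∘ Fin.suc) λ i → f≈ε (Fin.suc i) λ ())) (identityʳ (f Fin.zero))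
  sum-δ {suc n} f (Fin.suc j) f≈ε =
    ≈-trans (∙-cong (f≈ε Fin.zero λ ()) (sum-δ (f ∘ Fin.suc) j λ i i≢j → f≈ε (Fin.suc i) (i≢j ∘ FinP.suc-injective)))
            (identityˡ _)

module FiniteFieldProperties {q : ℕ} (F : FiniteField q) where
  open FiniteField F public
  open IsCommutativeRing isCommutativeRing public
    using (+-assoc; +-comm; +-identityˡ; +-identityʳ; *-assoc; *-comm; *-identityˡ; *-identityʳ;
           distribˡ; distribʳ; zeroˡ; zeroʳ; -‿inverseˡ; -‿inverseʳ)

  commutativeRing : CommutativeRing 0ℓ 0ℓ
  commutativeRing = record { isCommutativeRing = isCommutativeRing }

  open CommutativeRing commutativeRing public using (commutativeSemiring; +-commutativeMonoid; *-commutativeMonoid)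
  open GroupProperties (CommutativeRing.+-group commutativeRing) public using () renaming (∙-cancelʳ to +-cancelʳ)

  index : Carrier → Fin q
  index = Inverse.from enum

  u∘index : ∀ x → u (index x) ≡ x
  u∘index = Inverse.strictlyInverseˡ enum

  index∘u : ∀ i → index (u i) ≡ i
  index∘u = Inverse.strictlyInverseʳ enum

  u-injective : Injective _≡_ _≡_ u
  u-injective {i} {j} uᵢ≡uⱼ = trans (sym (index∘u i)) (trans (cong index uᵢ≡uⱼ) (index∘u j))

  search : (p : Carrier → Bool) → (∃[ x ] p x ≡ true) ⊎ (∀ x → p x ≡ false)
  search p with FinP.any? (λ i → p (u i) Data.Bool.≟ true)
  ... | yes (i , pᵢ) = inj₁ (u i , pᵢ)
  ... | no ∄i        = inj₂ λ x → BoolP.¬-not λ pₓ → ∄i (index x , trans (cong p (u∘index x)) pₓ)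

  search₂ : (p : Carrier → Carrier → Bool) → (∃[ x ] ∃[ y ] p x y ≡ true) ⊎ (∀ x y → p x y ≡ false)
  search₂ p with FinP.any? (λ i → FinP.any? (λ j → p (u i) (u j) Data.Bool.≟ true))
  ... | yes (i , j , pᵢⱼ) = inj₁ (u i , u j , pᵢⱼ)
  ... | no ∄ij            = inj₂ λ x y → BoolP.¬-not λ pxy →
          ∄ij (index x , index y , subst₂ (λ x′ y′ → p x′ y′ ≡ true) (sym (u∘index x)) (sym (u∘index y)) pxy)

  module FieldSums (M : CommutativeMonoid 0ℓ 0ℓ) where
    open CommutativeMonoid M using (_≈_; _∙_; ε; reflexive) renaming (Carrier to A; trans to ≈-trans)
    open MonoidSum M using (sum; sum-permute; sum-cong-≗; ∑-distrib-+)
    open FiniteSums M using (sum-δ)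

    ∑ : (Carrier → A) → A
    ∑ g = sum (g ∘ u)

    ∑-cong : ∀ {g h} → (∀ x → g x ≡ h x) → ∑ g ≡ ∑ h
    ∑-cong g≗h = sum-cong-≗ (g≗h ∘ u)

    ∑-distrib : ∀ g h → ∑ (λ x → g x ∙ h x) ≈ ∑ g ∙ ∑ h
    ∑-distrib g h = ∑-distrib-+ (g ∘ u) (h ∘ u)

    ∑-reindex : ∀ g (φ ψ : Carrier → Carrier) → (∀ x → φ (ψ x) ≡ x) → (∀ x → ψ (φ x) ≡ x) →
                ∑ g ≈ ∑ (g ∘ φ)
    ∑-reindex g φ ψ φ∘ψ ψ∘φ = ≈-trans (sum-permute (g ∘ u) π) (reflexive (sum-cong-≗ {q} λ i → cong g (u∘index (φ (u i)))))
      where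
      π : Permutation′ q
      π = permutation (λ i → index (φ (u i))) (λ j → index (ψ (u j)))
            (λ j → trans (cong (index ∘ φ) (u∘index _)) (trans (cong index (φ∘ψ (u j))) (index∘u j)))
            (λ i → trans (cong (index ∘ ψ) (u∘index _)) (trans (cong index (ψ∘φ (u i))) (index∘u i)))

    ∑-δ : ∀ g x₀ → (∀ x → x ≢ x₀ → g x ≈ ε) → ∑ g ≈ g x₀
    ∑-δ g x₀ g≈ε = ≈-trans
      (sum-δ (g ∘ u) (index x₀) λ i i≢ → g≈ε (u i) λ uᵢ≡x₀ → i≢ (trans (sym (index∘u i)) (cong index uᵢ≡x₀)))
      (reflexive (cong g (u∘index x₀)))

  module Sum = FieldSums +-commutativeMonoid
  module Product = FieldSums *-commutativeMonoid

  x*y≡0⇒y≡0 : ∀ {x y} → x ≢ 0# → x * y ≡ 0# → y ≡ 0#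
  x*y≡0⇒y≡0 {x} {y} x≢0 xy≡0 = begin
    y                ≡⟨ *-identityˡ y ⟨
    1# * y           ≡⟨ cong (_* y) (trans (*-comm (x ⁻¹) x) (⁻¹-inverse x x≢0)) ⟨
    (x ⁻¹ * x) * y   ≡⟨ *-assoc (x ⁻¹) x y ⟩
    x ⁻¹ * (x * y)   ≡⟨ cong (x ⁻¹ *_) xy≡0 ⟩
    x ⁻¹ * 0#        ≡⟨ zeroʳ _ ⟩
    0#               ∎
    where open ≡-Reasoning

  *-≢0 : ∀ {x y} → x ≢ 0# → y ≢ 0# → x * y ≢ 0#
  *-≢0 x≢0 y≢0 xy≡0 = y≢0 (x*y≡0⇒y≡0 x≢0 xy≡0)

  *-cancelʳ : ∀ {x y} z → z ≢ 0# → x * z ≡ y * z → x ≡ y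
  *-cancelʳ {x} {y} z z≢0 xz≡yz = begin
    x                 ≡⟨ *-identityʳ x ⟨
    x * 1#            ≡⟨ cong (x *_) (⁻¹-inverse z z≢0) ⟨
    x * (z * z ⁻¹)    ≡⟨ *-assoc x z _ ⟨
    (x * z) * z ⁻¹    ≡⟨ cong (_* z ⁻¹) xz≡yz ⟩
    (y * z) * z ⁻¹    ≡⟨ *-assoc y z _ ⟩
    y * (z * z ⁻¹)    ≡⟨ cong (y *_) (⁻¹-inverse z z≢0) ⟩
    y * 1#            ≡⟨ *-identityʳ y ⟩
    y                 ∎
    where open ≡-Reasoning

  x*[x⁻¹*y]≡y : ∀ {x} → x ≢ 0# → ∀ y → x * (x ⁻¹ * y) ≡ y
  x*[x⁻¹*y]≡y {x} x≢0 y = trans (sym (*-assoc x _ y)) (trans (cong (_* y) (⁻¹-inverse x x≢0)) (*-identityˡ y))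

  pow-≢0 : ∀ {x} n → x ≢ 0# → pow x n ≢ 0#
  pow-≢0 zero    x≢0 1≡0 = 0≢1 (sym 1≡0)
  pow-≢0 (suc n) x≢0     = *-≢0 x≢0 (pow-≢0 n x≢0)

  pow-+ : ∀ x m n → pow x (m ℕ.+ n) ≡ pow x m * pow x n
  pow-+ x zero    n = sym (*-identityˡ _)
  pow-+ x (suc m) n = trans (cong (x *_) (pow-+ x m n)) (sym (*-assoc x _ _))

  pow-0# : ∀ n → .{{ℕ.NonZero n}} → pow 0# n ≡ 0#
  pow-0# (suc n) = zeroˡ _

  Product-≢0 : ∀ f → (∀ x → f x ≢ 0#) → Product.∑ f ≢ 0#
  Product-≢0 f f≢0 = go (f≢0 ∘ u)
    where
    go : ∀ {n} {g : Fin n → Carrier} → (∀ i → g i ≢ 0#) → MonoidSum.sum *-commutativeMonoid g ≢ 0#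
    go {zero}  g≢0 1≡0 = 0≢1 (sym 1≡0)
    go {suc n} g≢0     = *-≢0 (g≢0 Fin.zero) (go (g≢0 ∘ Fin.suc))

  Product-const : ∀ c → Product.∑ (λ _ → c) ≡ pow c q
  Product-const c = go q
    where
    go : ∀ n → MonoidSum.sum *-commutativeMonoid {n} (λ _ → c) ≡ pow c n
    go zero    = refl
    go (suc n) = cong (c *_) (go n)

  isZero : Carrier → Bool
  isZero x = ⌊ x ≟ 0# ⌋

  -- Multiplication by a permutes the field; with 0 replaced by 1 (unit), the
  -- product over the field is invertible and can be cancelled.
  module _ {a : Carrier} (a≢0 : a ≢ 0#) where
    private
      unit scale δ : Carrier → Carrier
      unit  x = if isZero x then 1# else x
      scale x = if isZero x then 1# else a
      δ     x = if isZero x then a else 1#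

      unit≢0 : ∀ x → unit x ≢ 0#
      unit≢0 x with x ≟ 0#
      ... | yes _  = λ 1≡0 → 0≢1 (sym 1≡0)
      ... | no x≢0 = x≢0

      unit-* : ∀ x → unit (a * x) ≡ scale x * unit x
      unit-* x with x ≟ 0# | (a * x) ≟ 0#
      ... | yes _   | yes _    = sym (*-identityˡ 1#)
      ... | yes x≡0 | no ax≢0  = ⊥-elim (ax≢0 (trans (cong (a *_) x≡0) (zeroʳ a)))
      ... | no x≢0  | yes ax≡0 = ⊥-elim (x≢0 (x*y≡0⇒y≡0 a≢0 ax≡0))
      ... | no _    | no _     = refl

      scale*δ : ∀ x → scale x * δ x ≡ a
      scale*δ x with x ≟ 0#
      ... | yes _ = *-identityˡ a
      ... | no _  = *-identityʳ a

      a⁻¹*[a*x]≡x : ∀ x → a ⁻¹ * (a * x) ≡ x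
      a⁻¹*[a*x]≡x x = trans (sym (*-assoc _ a x)) (trans (cong (_* x) (trans (*-comm _ a) (⁻¹-inverse a a≢0))) (*-identityˡ x))

      ∏scale≡1 : Product.∑ scale ≡ 1#
      ∏scale≡1 = *-cancelʳ (Product.∑ unit) (Product-≢0 unit unit≢0) (begin
        Product.∑ scale * Product.∑ unit     ≡⟨ Product.∑-distrib scale unit ⟨
        Product.∑ (λ x → scale x * unit x)   ≡⟨ Product.∑-cong unit-* ⟨
        Product.∑ (λ x → unit (a * x))       ≡⟨ Product.∑-reindex unit (a *_) (a ⁻¹ *_) (x*[x⁻¹*y]≡y a≢0) a⁻¹*[a*x]≡x ⟨
        Product.∑ unit                       ≡⟨ *-identityˡ _ ⟨
        1# * Product.∑ unit                  ∎)
        where open ≡-Reasoning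

      ∏δ≡a : Product.∑ δ ≡ a
      ∏δ≡a = trans (Product.∑-δ δ 0# δ≡1) (δ0≡a (0# ≟ 0#))
        where
        δ≡1 : ∀ x → x ≢ 0# → δ x ≡ 1#
        δ≡1 x x≢0 with x ≟ 0#
        ... | yes x≡0 = ⊥-elim (x≢0 x≡0)
        ... | no _    = refl
        δ0≡a : ∀ d → (if ⌊ d ⌋ then a else 1#) ≡ a
        δ0≡a (yes _)  = refl
        δ0≡a (no 0≢0) = ⊥-elim (0≢0 refl)

    fermat-≢0 : pow a q ≡ a
    fermat-≢0 = begin
      pow a q                           ≡⟨ Product-const a ⟨
      Product.∑ (λ _ → a)               ≡⟨ Product.∑-cong scale*δ ⟨
      Product.∑ (λ x → scale x * δ x)   ≡⟨ Product.∑-distrib scale δ ⟩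
      Product.∑ scale * Product.∑ δ     ≡⟨ cong₂ _*_ ∏scale≡1 ∏δ≡a ⟩
      1# * a                            ≡⟨ *-identityˡ a ⟩
      a                                 ∎
      where open ≡-Reasoning

  fermat : ∀ x → pow x q ≡ x
  fermat x with x ≟ 0#
  ... | yes refl = pow-0# q {{FinP.nonZeroIndex (index 0#)}}
  ... | no x≢0   = fermat-≢0 x≢0

-- Fields with 2^k elements: characteristic two and the absolute trace

module BinaryFieldProperties (k : ℕ) (F : FiniteField (2 ℕ.^ k)) where
  open FiniteFieldProperties F public
  open CommutativeRing commutativeRing using (semiring)
  open SemiringMult semiring using (×1-homo-*) renaming (_×_ to _·_)
  open NaturalSolver commutativeSemiring using (solve; _:+_; _:*_; _:=_; con)

  2^j·1≡[1+1]^j : ∀ j → (2 ℕ.^ j) · 1# ≡ pow (1# + 1#) j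
  2^j·1≡[1+1]^j zero    = +-identityʳ 1#
  2^j·1≡[1+1]^j (suc j) = trans (×1-homo-* 2 (2 ℕ.^ j)) (cong₂ _*_ (cong (1# +_) (+-identityʳ 1#)) (2^j·1≡[1+1]^j j))

  q·1≡0 : (2 ℕ.^ k) · 1# ≡ 0#
  q·1≡0 = +-cancelʳ (Sum.∑ (λ x → x)) _ _ (begin
    (2 ℕ.^ k) · 1# + Sum.∑ (λ x → x)   ≡⟨ cong (_+ Sum.∑ (λ x → x)) (MonoidSum.sum-replicate +-commutativeMonoid (2 ℕ.^ k)) ⟨
    Sum.∑ (λ _ → 1#) + Sum.∑ (λ x → x) ≡⟨ +-comm _ _ ⟩
    Sum.∑ (λ x → x) + Sum.∑ (λ _ → 1#) ≡⟨ Sum.∑-distrib (λ x → x) (λ _ → 1#) ⟨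
    Sum.∑ (λ x → x + 1#)               ≡⟨ Sum.∑-reindex (λ x → x) (_+ 1#) (_+ - 1#) (cancel (-‿inverseˡ 1#)) (cancel (-‿inverseʳ 1#)) ⟨
    Sum.∑ (λ x → x)                    ≡⟨ +-identityˡ _ ⟨
    0# + Sum.∑ (λ x → x)               ∎)
    where
    open ≡-Reasoning
    cancel : ∀ {a b} → a + b ≡ 0# → ∀ x → (x + a) + b ≡ x
    cancel {a} {b} a+b≡0 x = trans (+-assoc x a b) (trans (cong (x +_) a+b≡0) (+-identityʳ x))

  1+1≡0 : 1# + 1# ≡ 0#
  1+1≡0 with (1# + 1#) ≟ 0#
  ... | yes 1+1≡0 = 1+1≡0
  ... | no 1+1≢0  = ⊥-elim (pow-≢0 k 1+1≢0 (trans (sym (2^j·1≡[1+1]^j k)) q·1≡0))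

  x+x≡0 : ∀ x → x + x ≡ 0#
  x+x≡0 x = begin
    x + x           ≡⟨ solve 1 (λ x → x :+ x := (con 1 :+ con 1) :* x) refl x ⟩
    (1# + 1#) * x   ≡⟨ cong (_* x) 1+1≡0 ⟩
    0# * x          ≡⟨ zeroˡ x ⟩
    0#              ∎
    where open ≡-Reasoning

  x+y≡0⇒x≡y : ∀ {x y} → x + y ≡ 0# → x ≡ y
  x+y≡0⇒x≡y {x} {y} x+y≡0 = +-cancelʳ y _ _ (trans x+y≡0 (sym (x+x≡0 y)))

  k≢0 : k ≢ 0
  k≢0 refl = 0≢1 (begin
    0#             ≡⟨ u∘index 0# ⟨
    u (index 0#)   ≡⟨ cong u (Fin1-unique (index 0#) (index 1#)) ⟩
    u (index 1#)   ≡⟨ u∘index 1# ⟩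
    1#             ∎)
    where
    open ≡-Reasoning
    Fin1-unique : (i j : Fin 1) → i ≡ j
    Fin1-unique Fin.zero Fin.zero = refl

  square : Carrier → Carrier
  square x = x * x

  square-+ : ∀ x y → square (x + y) ≡ square x + square y
  square-+ x y = begin
    (x + y) * (x + y)                  ≡⟨ solve 2 (λ x y → (x :+ y) :* (x :+ y) := (x :* x :+ y :* y) :+ (x :* y :+ x :* y)) refl x y ⟩
    (x * x + y * y) + (x * y + x * y)  ≡⟨ cong ((x * x + y * y) +_) (x+x≡0 (x * y)) ⟩
    (x * x + y * y) + 0#               ≡⟨ +-identityʳ _ ⟩
    x * x + y * y                      ∎
    where open ≡-Reasoning

  pow-2^suc : ∀ x j → pow x (2 ℕ.^ suc j) ≡ square (pow x (2 ℕ.^ j))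
  pow-2^suc x j = trans (pow-+ x (2 ℕ.^ j) _) (cong (pow x (2 ℕ.^ j) *_) (trans (pow-+ x (2 ℕ.^ j) 0) (*-identityʳ _)))

  frobenius : ∀ j x y → pow (x + y) (2 ℕ.^ j) ≡ pow x (2 ℕ.^ j) + pow y (2 ℕ.^ j)
  frobenius zero    x y = trans (*-identityʳ _) (sym (cong₂ _+_ (*-identityʳ x) (*-identityʳ y)))
  frobenius (suc j) x y = begin
    pow (x + y) (2 ℕ.^ suc j)                            ≡⟨ pow-2^suc (x + y) j ⟩
    square (pow (x + y) (2 ℕ.^ j))                       ≡⟨ cong square (frobenius j x y) ⟩
    square (pow x (2 ℕ.^ j) + pow y (2 ℕ.^ j))           ≡⟨ square-+ _ _ ⟩
    square (pow x (2 ℕ.^ j)) + square (pow y (2 ℕ.^ j))  ≡⟨ cong₂ _+_ (pow-2^suc x j) (pow-2^suc y j) ⟨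
    pow x (2 ℕ.^ suc j) + pow y (2 ℕ.^ suc j)            ∎
    where open ≡-Reasoning

  traceSum-+ : ∀ j x y → traceSum j (x + y) ≡ traceSum j x + traceSum j y
  traceSum-+ zero    x y = sym (+-identityʳ 0#)
  traceSum-+ (suc j) x y = trans (cong₂ _+_ (traceSum-+ j x y) (frobenius j x y))
    (solve 4 (λ a b c d → (a :+ b) :+ (c :+ d) := (a :+ c) :+ (b :+ d)) refl _ _ _ _)

  traceSum-0 : ∀ j → traceSum j 0# ≡ 0#
  traceSum-0 zero    = refl
  traceSum-0 (suc j) = trans (cong₂ _+_ (traceSum-0 j) (pow-0# (2 ℕ.^ j) {{ℕP.m^n≢0 2 j}})) (+-identityʳ 0#)

  square-traceSum : ∀ j x → square (traceSum j x) + x ≡ traceSum j x + pow x (2 ℕ.^ j)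
  square-traceSum zero    x = trans (cong (_+ x) (zeroˡ 0#)) (trans (+-identityˡ x) (sym (trans (+-identityˡ _) (*-identityʳ x))))
  square-traceSum (suc j) x = begin
    square (T + p) + x              ≡⟨ cong (_+ x) (square-+ T p) ⟩
    (square T + square p) + x       ≡⟨ solve 3 (λ a b c → (a :+ b) :+ c := (a :+ c) :+ b) refl (square T) (square p) x ⟩
    (square T + x) + square p       ≡⟨ cong (_+ square p) (square-traceSum j x) ⟩
    (T + p) + square p              ≡⟨ cong ((T + p) +_) (pow-2^suc x j) ⟨
    (T + p) + pow x (2 ℕ.^ suc j)   ∎
    where
    open ≡-Reasoning
    T = traceSum j x
    p = pow x (2 ℕ.^ j)

  trace≡0⊎1 : ∀ x → traceSum k x ≡ 0# ⊎ traceSum k x ≡ 1#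
  trace≡0⊎1 x with traceSum k x ≟ 0#
  ... | yes T≡0 = inj₁ T≡0
  ... | no T≢0  = inj₂ (*-cancelʳ _ T≢0 (trans square-T≡T (sym (*-identityˡ _))))
    where
    square-T≡T : square (traceSum k x) ≡ traceSum k x
    square-T≡T = +-cancelʳ x _ _ (trans (square-traceSum k x) (cong (traceSum k x +_) (fermat x)))

  -- Polynomial c d g: g is a polynomial function of degree ≤ d with coefficient c
  -- at xᵈ, described by its divided differences g x = g a + (x + a) · h x.
  Polynomial : Carrier → ℕ → (Carrier → Carrier) → Set
  Polynomial c zero    g = ∀ x → g x ≡ c
  Polynomial c (suc d) g = ∀ a → ∃[ h ] Polynomial c d h × (∀ x → g x ≡ g a + (x + a) * h x)

  Polynomial-+ : ∀ {c c′} d {g h} → Polynomial c d g → Polynomial c′ d h → Polynomial (c + c′) d (λ x → g x + h x)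
  Polynomial-+ zero    g≡c h≡c′ x = cong₂ _+_ (g≡c x) (h≡c′ x)
  Polynomial-+ (suc d) {g} {h} g-poly h-poly a with g-poly a | h-poly a
  ... | g′ , g′-poly , g≡ | h′ , h′-poly , h≡ = (λ x → g′ x + h′ x) , Polynomial-+ d g′-poly h′-poly , λ x →
    trans (cong₂ _+_ (g≡ x) (h≡ x))
      (solve 5 (λ ga ha xa p q → (ga :+ xa :* p) :+ (ha :+ xa :* q) := (ga :+ ha) :+ xa :* (p :+ q)) refl
        (g a) (h a) (x + a) (g′ x) (h′ x))

  Polynomial-scale : ∀ {c} d b {g} → Polynomial c d g → Polynomial (b * c) d (λ x → b * g x)
  Polynomial-scale zero    b g≡c x = cong (b *_) (g≡c x)
  Polynomial-scale (suc d) b {g} g-poly a with g-poly a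
  ... | h , h-poly , g≡ = (λ x → b * h x) , Polynomial-scale d b h-poly , λ x → trans (cong (b *_) (g≡ x))
    (solve 4 (λ b ga xa hx → b :* (ga :+ xa :* hx) := b :* ga :+ xa :* (b :* hx)) refl b (g a) (x + a) (h x))

  Polynomial-suc : ∀ {c} d {g} → Polynomial c d g → Polynomial 0# (suc d) g
  Polynomial-suc zero    {g} g≡c a = (λ _ → 0#) , (λ _ → refl) , λ x → begin
    g x                  ≡⟨ trans (g≡c x) (sym (g≡c a)) ⟩
    g a                  ≡⟨ +-identityʳ (g a) ⟨
    g a + 0#             ≡⟨ cong (g a +_) (zeroʳ (x + a)) ⟨
    g a + (x + a) * 0#   ∎
    where open ≡-Reasoning
  Polynomial-suc (suc d) g-poly a with g-poly a
  ... | h , h-poly , g≡ = h , Polynomial-suc d h-poly , g≡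

  Polynomial-≤ : ∀ {d e g} → d ≤ e → Polynomial 0# d g → Polynomial 0# e g
  Polynomial-≤ {d} {g = g} d≤e g-poly with ℕP.m≤n⇒∃[o]m+o≡n d≤e
  ... | o , refl = raise o
    where
    raise : ∀ o → Polynomial 0# (d ℕ.+ o) g
    raise zero    rewrite ℕP.+-identityʳ d = g-poly
    raise (suc o) rewrite ℕP.+-suc d o     = Polynomial-suc (d ℕ.+ o) (raise o)

  pow-Polynomial : ∀ n → Polynomial 1# n (λ x → pow x n)
  pow-Polynomial zero    x = refl
  pow-Polynomial (suc n) a with Polynomial-suc n (pow-Polynomial n) a
  ... | h , h-poly , xⁿ≡ = (λ x → pow x n + a * h x) ,
    subst (λ c → Polynomial c n (λ x → pow x n + a * h x)) (trans (cong (1# +_) (zeroʳ a)) (+-identityʳ 1#))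
      (Polynomial-+ n (pow-Polynomial n) (Polynomial-scale n a h-poly)) ,
    λ x → sym (factor x (pow x n) (xⁿ≡ x))
    where
    factor : ∀ x X → X ≡ pow a n + (x + a) * h x → a * pow a n + (x + a) * (X + a * h x) ≡ x * X
    factor x X X≡ = begin
      a * A + (x + a) * (X + a * H)                 ≡⟨ solve 5 (λ x a X A H → a :* A :+ (x :+ a) :* (X :+ a :* H)
                                                         := x :* X :+ (a :* A :+ a :* X :+ a :* ((x :+ a) :* H))) refl x a X A H ⟩
      x * X + (a * A + a * X + a * B)               ≡⟨ cong (λ Y → x * X + (a * A + a * Y + a * B)) X≡ ⟩
      x * X + (a * A + a * (A + B) + a * B)         ≡⟨ cong (x * X +_) (solve 3 (λ a A B → a :* A :+ a :* (A :+ B) :+ a :* B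
                                                         := (a :* A :+ a :* A) :+ (a :* B :+ a :* B)) refl a A B) ⟩
      x * X + ((a * A + a * A) + (a * B + a * B))   ≡⟨ cong (x * X +_) (trans (cong₂ _+_ (x+x≡0 _) (x+x≡0 _)) (+-identityʳ 0#)) ⟩
      x * X + 0#                                    ≡⟨ +-identityʳ _ ⟩
      x * X                                         ∎
      where
      open ≡-Reasoning
      A = pow a n
      H = h x
      B = (x + a) * h x

  polynomial-root-bound : ∀ {c} d {g} → c ≢ 0# → Polynomial c d g →
                          (r : Fin (suc d) → Carrier) → Injective _≡_ _≡_ r → ¬ (∀ i → g (r i) ≡ 0#)
  polynomial-root-bound zero    c≢0 g≡c r r-inj roots = c≢0 (trans (sym (g≡c (r Fin.zero))) (roots Fin.zero))
  polynomial-root-bound (suc d) {g} c≢0 g-poly r r-inj roots with g-poly (r Fin.zero)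
  ... | h , h-poly , g≡ = polynomial-root-bound d c≢0 h-poly (r ∘ Fin.suc) (FinP.suc-injective ∘ r-inj) h-roots
    where
    h-roots : ∀ i → h (r (Fin.suc i)) ≡ 0#
    h-roots i = x*y≡0⇒y≡0 (λ rᵢ+r₀≡0 → FinP.0≢1+n (sym (r-inj (x+y≡0⇒x≡y rᵢ+r₀≡0)))) (begin
      (rᵢ + r₀) * h rᵢ         ≡⟨ +-identityˡ _ ⟨
      0# + (rᵢ + r₀) * h rᵢ    ≡⟨ cong (_+ (rᵢ + r₀) * h rᵢ) (roots Fin.zero) ⟨
      g r₀ + (rᵢ + r₀) * h rᵢ  ≡⟨ g≡ rᵢ ⟨
      g rᵢ                     ≡⟨ roots (Fin.suc i) ⟩
      0#                       ∎)
      where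
      open ≡-Reasoning
      r₀ = r Fin.zero
      rᵢ = r (Fin.suc i)

  traceSum-suc-Polynomial : ∀ j → Polynomial 1# (2 ℕ.^ j) (traceSum (suc j))
  traceSum-Polynomial : ∀ j → Polynomial 0# (2 ℕ.^ j) (traceSum j)

  traceSum-suc-Polynomial j = subst (λ c → Polynomial c (2 ℕ.^ j) (traceSum (suc j))) (+-identityˡ 1#)
    (Polynomial-+ (2 ℕ.^ j) (traceSum-Polynomial j) (pow-Polynomial (2 ℕ.^ j)))

  traceSum-Polynomial zero    = Polynomial-suc {c = 0#} 0 (λ _ → refl)
  traceSum-Polynomial (suc j) = Polynomial-≤ (ℕP.^-monoʳ-< 2 (ℕP.n<1+n 1) (ℕP.n<1+n j))
                                  (Polynomial-suc (2 ℕ.^ j) (traceSum-suc-Polynomial j))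

  trace-not-identically-0 : ¬ (∀ x → traceSum k x ≡ 0#)
  trace-not-identically-0 trace≡0 =
    polynomial-root-bound (2 ℕ.^ j) (0≢1 ∘ sym) (traceSum-suc-Polynomial j) r r-injective
      (λ i → subst (λ n → traceSum n (r i) ≡ 0#) (sym 1+j≡k) (trace≡0 (r i)))
    where
    j = ℕ.pred k
    1+j≡k : suc j ≡ k
    1+j≡k = ℕP.suc-pred k {{ℕ.≢-nonZero k≢0}}
    1+2^j≤q : suc (2 ℕ.^ j) ≤ 2 ℕ.^ k
    1+2^j≤q = subst (λ n → 2 ℕ.^ j ℕ.< 2 ℕ.^ n) 1+j≡k (ℕP.^-monoʳ-< 2 (ℕP.n<1+n 1) (ℕP.n<1+n j))
    r : Fin (suc (2 ℕ.^ j)) → Carrier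
    r i = u (Fin.inject≤ i 1+2^j≤q)
    r-injective : Injective _≡_ _≡_ r
    r-injective = FinP.inject≤-injective 1+2^j≤q 1+2^j≤q _ _ ∘ u-injective

  -- For k = 2m this is definitionally the trace tr m F.
  trᵇ : Carrier → Bool
  trᵇ x = not (isZero (traceSum k x))

  ⟦_⟧ : Bool → Carrier
  ⟦ false ⟧ = 0#
  ⟦ true  ⟧ = 1#

  ⟦⟧-xor : ∀ a b → ⟦ a xor b ⟧ ≡ ⟦ a ⟧ + ⟦ b ⟧
  ⟦⟧-xor false b     = sym (+-identityˡ _)
  ⟦⟧-xor true  false = sym (+-identityʳ 1#)
  ⟦⟧-xor true  true  = sym 1+1≡0

  ⟦⟧-injective : ∀ {a b} → ⟦ a ⟧ ≡ ⟦ b ⟧ → a ≡ b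
  ⟦⟧-injective {false} {false} _   = refl
  ⟦⟧-injective {false} {true}  0≡1 = ⊥-elim (0≢1 0≡1)
  ⟦⟧-injective {true}  {false} 1≡0 = ⊥-elim (0≢1 (sym 1≡0))
  ⟦⟧-injective {true}  {true}  _   = refl

  trace≡⟦trᵇ⟧ : ∀ x → traceSum k x ≡ ⟦ trᵇ x ⟧
  trace≡⟦trᵇ⟧ x with traceSum k x ≟ 0# | trace≡0⊎1 x
  ... | yes T≡0 | _        = T≡0
  ... | no T≢0  | inj₁ T≡0 = ⊥-elim (T≢0 T≡0)
  ... | no _    | inj₂ T≡1 = T≡1

  trᵇ-+ : ∀ x y → trᵇ (x + y) ≡ trᵇ x xor trᵇ y
  trᵇ-+ x y = ⟦⟧-injective (begin
    ⟦ trᵇ (x + y) ⟧               ≡⟨ trace≡⟦trᵇ⟧ (x + y) ⟨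
    traceSum k (x + y)            ≡⟨ traceSum-+ k x y ⟩
    traceSum k x + traceSum k y   ≡⟨ cong₂ _+_ (trace≡⟦trᵇ⟧ x) (trace≡⟦trᵇ⟧ y) ⟩
    ⟦ trᵇ x ⟧ + ⟦ trᵇ y ⟧         ≡⟨ ⟦⟧-xor (trᵇ x) (trᵇ y) ⟨
    ⟦ trᵇ x xor trᵇ y ⟧           ∎)
    where open ≡-Reasoning

  trᵇ-0 : trᵇ 0# ≡ false
  trᵇ-0 = ⟦⟧-injective (trans (sym (trace≡⟦trᵇ⟧ 0#)) (traceSum-0 k))

  trᵇ-surjective : ∃[ x ] trᵇ x ≡ true
  trᵇ-surjective with search trᵇ
  ... | inj₁ found     = found
  ... | inj₂ trᵇ≡false = ⊥-elim (trace-not-identically-0 λ x → trans (trace≡⟦trᵇ⟧ x) (cong ⟦_⟧ (trᵇ≡false x)))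

-- Walsh transforms

signBit : ℤ → Bool
signBit (ℤ.+ _)  = false
signBit -[1+ _ ] = true

sgn[signBit]*i≡∣i∣ : ∀ i → sgn (signBit i) ℤ.* i ≡ ℤ.+ ℤ.∣ i ∣
sgn[signBit]*i≡∣i∣ (ℤ.+ n)  = ℤP.*-identityˡ (ℤ.+ n)
sgn[signBit]*i≡∣i∣ -[1+ n ] = ℤP.-1*i≡-i -[1+ n ]

i≡sgn[signBit]*∣i∣ : ∀ i → i ≡ sgn (signBit i) ℤ.* ℤ.+ ℤ.∣ i ∣
i≡sgn[signBit]*∣i∣ (ℤ.+ n)  = sym (ℤP.*-identityˡ (ℤ.+ n))
i≡sgn[signBit]*∣i∣ -[1+ n ] = sym (ℤP.-1*i≡-i (ℤ.+ suc n))

i≤+∣i∣ : ∀ i → i ℤ.≤ ℤ.+ ℤ.∣ i ∣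
i≤+∣i∣ (ℤ.+ n)  = ℤP.≤-refl
i≤+∣i∣ -[1+ n ] = ℤ.-≤+

∣sgn*i∣ : ∀ b i → ℤ.∣ sgn b ℤ.* i ∣ ≡ ℤ.∣ i ∣
∣sgn*i∣ false i = cong ℤ.∣_∣ (ℤP.*-identityˡ i)
∣sgn*i∣ true  i = trans (cong ℤ.∣_∣ (ℤP.-1*i≡-i i)) (ℤP.∣-i∣≡∣i∣ i)

i≡-i⇒i≡0 : ∀ i → i ≡ ℤ.- i → i ≡ 0ℤ
i≡-i⇒i≡0 (ℤ.+ zero)  _  = refl
i≡-i⇒i≡0 (ℤ.+ suc n) ()
i≡-i⇒i≡0 -[1+ n ]    ()

module _ (m : ℕ) (F : GF m) where

  combo-xor : ∀ {s} (a a′ : Fin s → Bool) (gs : Fin s → BoolFun m F) x →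
              combo m F (λ j → a j xor a′ j) gs x ≡ combo m F a gs x xor combo m F a′ gs x
  combo-xor {zero}  a a′ gs x = refl
  combo-xor {suc s} a a′ gs x = trans
    (cong (((a Fin.zero xor a′ Fin.zero) ∧ gs Fin.zero x) xor_) (combo-xor (a ∘ Fin.suc) (a′ ∘ Fin.suc) (gs ∘ Fin.suc) x))
    (solve 5 (λ p p′ f r r′ → ((p :+ p′) :* f) :+ (r :+ r′) := ((p :* f) :+ r) :+ ((p′ :* f) :+ r′)) refl
      (a Fin.zero) (a′ Fin.zero) (gs Fin.zero x) _ _)
    where open BoolSolver

  combo-0 : ∀ {s} (a : Fin s → Bool) (gs : Fin s → BoolFun m F) x → (∀ j → a j ≡ false) → combo m F a gs x ≡ false
  combo-0 {zero}  a gs x a≡0 = refl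
  combo-0 {suc s} a gs x a≡0 rewrite a≡0 Fin.zero = combo-0 (a ∘ Fin.suc) (gs ∘ Fin.suc) x (a≡0 ∘ Fin.suc)

module WalshAnalysis (m : ℕ) (F : GF m) where
  open BinaryFieldProperties (2 ℕ.* m) F public
  module Int = FieldSums (Semiring.+-commutativeMonoid ℤP.+-*-semiring)

  sign≡sgn : ∀ b → sign m F b ≡ sgn b
  sign≡sgn false = refl
  sign≡sgn true  = refl

  Σℤ≡sum : ∀ n g → Σℤ m F n g ≡ ∑ℤ.sum g
  Σℤ≡sum zero    g = refl
  Σℤ≡sum (suc n) g = cong (ℤ._+_ (g Fin.zero)) (Σℤ≡sum n (g ∘ Fin.suc))

  walsh≡∑ : ∀ f w → walsh m F f w ≡ Int.∑ (λ x → sgn (f x xor trᵇ (w * x)))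
  walsh≡∑ f w = trans (Σℤ≡sum (q m F) _) (Int.∑-cong λ x → sign≡sgn (f x xor trᵇ (w * x)))

  truthTable-⊕ : ∀ f g → truthTable m F f ⊕ truthTable m F g ≡ truthTable m F (λ x → f x xor g x)
  truthTable-⊕ f g = ≗-lookup⇒≡ λ i → trans (lookup-zipWith _xor_ i (truthTable m F f) (truthTable m F g))
    (trans (cong₂ _xor_ (lookup∘tabulate (f ∘ u) i) (lookup∘tabulate (g ∘ u) i))
           (sym (lookup∘tabulate (λ i → f (u i) xor g (u i)) i)))

  truthTable-cong : ∀ {f g} → (∀ x → f x ≡ g x) → truthTable m F f ≡ truthTable m F g
  truthTable-cong f≗g = tabulate-cong (f≗g ∘ u)

  truthTable-false : truthTable m F (λ _ → false) ≡ ∅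
  truthTable-false = ≗-lookup⇒≡ λ i → trans (lookup∘tabulate {n = q m F} (λ _ → false) i) (sym (lookup-replicate i false))

  signedSum-truthTable : ∀ f → signedSum (truthTable m F f) ≡ Int.∑ (sgn ∘ f)
  signedSum-truthTable f = ∑ℤ.sum-cong-≗ {q m F} λ i → cong sgn (lookup∘tabulate (f ∘ u) i)

  ∑sgn-scale : ∀ b (f : Carrier → Bool) → Int.∑ (λ x → sgn (b xor f x)) ≡ sgn b ℤ.* Int.∑ (sgn ∘ f)
  ∑sgn-scale b f = trans (Int.∑-cong λ x → sgn-xor b (f x)) (sym (∑ℤ.*-distribˡ-sum (sgn b) (sgn ∘ f ∘ u)))

  ∑sgn-false : Int.∑ (λ _ → sgn false) ≡ ℤ.+ q m F
  ∑sgn-false = go (q m F)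
    where
    go : ∀ n → ∑ℤ.sum {n} (λ _ → 1ℤ) ≡ ℤ.+ n
    go zero    = refl
    go (suc n) = cong (ℤ._+_ 1ℤ) (go n)

  ∑sgn-balanced : ∀ (h : Carrier → Bool) → (∀ x y → h (x + y) ≡ h x xor h y) →
                  ∀ x₀ → h x₀ ≡ true → Int.∑ (sgn ∘ h) ≡ 0ℤ
  ∑sgn-balanced h h-+ x₀ hx₀≡true = i≡-i⇒i≡0 _ (begin
    Int.∑ (sgn ∘ h)                    ≡⟨ Int.∑-reindex (sgn ∘ h) (_+ x₀) (_+ x₀) +x₀+x₀ +x₀+x₀ ⟩
    Int.∑ (λ x → sgn (h (x + x₀)))     ≡⟨ Int.∑-cong (λ x → cong sgn (trans (h-+ x x₀) (cong (h x xor_) hx₀≡true))) ⟩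
    Int.∑ (λ x → sgn (h x xor true))   ≡⟨ Int.∑-cong (λ x → cong sgn (BoolP.xor-comm (h x) true)) ⟩
    Int.∑ (λ x → sgn (true xor h x))   ≡⟨ ∑sgn-scale true h ⟩
    -1ℤ ℤ.* Int.∑ (sgn ∘ h)            ≡⟨ ℤP.-1*i≡-i _ ⟩
    ℤ.- Int.∑ (sgn ∘ h)                ∎)
    where
    open ≡-Reasoning
    +x₀+x₀ : ∀ x → (x + x₀) + x₀ ≡ x
    +x₀+x₀ x = trans (+-assoc x x₀ x₀) (trans (cong (x +_) (x+x≡0 x₀)) (+-identityʳ x))

  ∑sgn-additive : ∀ (h : Carrier → Bool) → (∀ x y → h (x + y) ≡ h x xor h y) →
                  Int.∑ (sgn ∘ h) ≡ 0ℤ ⊎ Int.∑ (sgn ∘ h) ≡ ℤ.+ q m F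
  ∑sgn-additive h h-+ with search h
  ... | inj₁ (x₀ , hx₀≡true) = inj₁ (∑sgn-balanced h h-+ x₀ hx₀≡true)
  ... | inj₂ h≡false         = inj₂ (trans (Int.∑-cong (cong sgn ∘ h≡false)) ∑sgn-false)

  character-sum-≢0 : ∀ {b} → b ≢ 0# → Int.∑ (λ x → sgn (trᵇ (b * x))) ≡ 0ℤ
  character-sum-≢0 {b} b≢0 with trᵇ-surjective
  ... | y , trᵇy≡true = ∑sgn-balanced (λ x → trᵇ (b * x)) (λ x y → trans (cong trᵇ (distribˡ b x y)) (trᵇ-+ _ _))
                          (b ⁻¹ * y) (trans (cong trᵇ (x*[x⁻¹*y]≡y b≢0 y)) trᵇy≡true)

  character-sum-0 : Int.∑ (λ x → sgn (trᵇ (0# * x))) ≡ ℤ.+ q m F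
  character-sum-0 = trans (Int.∑-cong λ x → cong sgn (trans (cong trᵇ (zeroˡ x)) trᵇ-0)) ∑sgn-false

  ∑walsh : ∀ f → Int.∑ (walsh m F f) ≡ sgn (f 0#) ℤ.* ℤ.+ q m F
  ∑walsh f = begin
    Int.∑ (walsh m F f)                                           ≡⟨ Int.∑-cong (walsh≡∑ f) ⟩
    Int.∑ (λ w → Int.∑ (λ x → sgn (f x xor trᵇ (w * x))))         ≡⟨ ∑ℤ.∑-comm (λ j i → sgn (f (u i) xor trᵇ (u j * u i))) ⟩
    Int.∑ (λ x → Int.∑ (λ w → sgn (f x xor trᵇ (w * x))))         ≡⟨ Int.∑-cong (λ x → Int.∑-cong λ w →
                                                                       cong (λ y → sgn (f x xor trᵇ y)) (*-comm w x)) ⟩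
    Int.∑ (λ x → Int.∑ (λ w → sgn (f x xor trᵇ (x * w))))         ≡⟨ Int.∑-cong (λ x → ∑sgn-scale (f x) λ w → trᵇ (x * w)) ⟩
    Int.∑ (λ x → sgn (f x) ℤ.* Int.∑ (λ w → sgn (trᵇ (x * w))))   ≡⟨ Int.∑-δ _ 0# (λ x x≢0 →
                                                                       trans (cong (sgn (f x) ℤ.*_) (character-sum-≢0 x≢0)) (ℤP.*-zeroʳ (sgn (f x)))) ⟩
    sgn (f 0#) ℤ.* Int.∑ (λ w → sgn (trᵇ (0# * w)))               ≡⟨ cong (sgn (f 0#) ℤ.*_) character-sum-0 ⟩
    sgn (f 0#) ℤ.* ℤ.+ q m F                                      ∎
    where open ≡-Reasoning

  m≢0 : m ≢ 0
  m≢0 m≡0 = k≢0 (cong (2 ℕ.*_) m≡0)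

  2^m<q : 2 ℕ.^ m ℕ.< q m F
  2^m<q = ℕP.^-monoʳ-< 2 (ℕP.n<1+n 1) (subst (m ℕ.<_) (ℕP.*-comm m 2) (ℕP.m<m*n m 2 {{ℕ.≢-nonZero m≢0}} (ℕP.n<1+n 1)))

  2^m*∣i∣≢q : ∀ {i} → i ≡ 0ℤ ⊎ i ≡ ℤ.+ q m F → 2 ℕ.^ m ℕ.* ℤ.∣ i ∣ ≢ q m F
  2^m*∣i∣≢q (inj₁ refl) 2^m*0≡q = ℕP.<⇒≢ (ℕP.m^n>0 2 (2 ℕ.* m)) (trans (sym (ℕP.*-zeroʳ (2 ℕ.^ m))) 2^m*0≡q)
  2^m*∣i∣≢q (inj₂ refl) 2^m*q≡q = ℕP.<⇒≢ (ℕP.^-monoʳ-< 2 (ℕP.n<1+n 1) (ℕP.n≢0⇒n>0 m≢0))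
    (sym (ℕP.*-cancelʳ-≡ (2 ℕ.^ m) 1 (q m F) {{ℕP.m^n≢0 2 (2 ℕ.* m)}} (trans 2^m*q≡q (sym (ℕP.*-identityˡ (q m F))))))

  dual : BoolFun m F → BoolFun m F
  dual f b = signBit (walsh m F f b)

  walsh≡sgn[dual]*2^m : ∀ {f} → IsBent m F f → ∀ b → walsh m F f b ≡ sgn (dual f b) ℤ.* ℤ.+ (2 ℕ.^ m)
  walsh≡sgn[dual]*2^m {f} f-bent b =
    trans (i≡sgn[signBit]*∣i∣ (walsh m F f b)) (cong (λ n → sgn (dual f b) ℤ.* ℤ.+ n) (f-bent b))

  2^m*∣∑sgn[dual⊕d]∣≡q : ∀ {f} → IsBent m F f → ∀ d → 2 ℕ.^ m ℕ.* ℤ.∣ Int.∑ (λ b → sgn (dual f b xor d)) ∣ ≡ q m F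
  2^m*∣∑sgn[dual⊕d]∣≡q {f} f-bent d = begin
    2 ℕ.^ m ℕ.* ℤ.∣ L ∣              ≡⟨ ℤP.abs-* 2^m L ⟨
    ℤ.∣ 2^m ℤ.* L ∣                  ≡⟨ ∣sgn*i∣ d _ ⟨
    ℤ.∣ sgn d ℤ.* (2^m ℤ.* L) ∣      ≡⟨ cong ℤ.∣_∣ ∑walsh≡ ⟨
    ℤ.∣ Int.∑ (walsh m F f) ∣        ≡⟨ cong ℤ.∣_∣ (∑walsh f) ⟩
    ℤ.∣ sgn (f 0#) ℤ.* ℤ.+ q m F ∣   ≡⟨ ∣sgn*i∣ (f 0#) _ ⟩
    q m F                            ∎
    where
    open ≡-Reasoning
    2^m = ℤ.+ (2 ℕ.^ m)
    L = Int.∑ (λ b → sgn (dual f b xor d))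

    sgn[d]*sgn[d]≡1 : sgn d ℤ.* sgn d ≡ 1ℤ
    sgn[d]*sgn[d]≡1 = trans (sym (sgn-xor d d)) (cong sgn (BoolP.xor-same d))

    walsh≡ : ∀ b → walsh m F f b ≡ sgn d ℤ.* (2^m ℤ.* sgn (dual f b xor d))
    walsh≡ b = begin
      walsh m F f b                                     ≡⟨ walsh≡sgn[dual]*2^m {f} f-bent b ⟩
      sgn (dual f b) ℤ.* 2^m                            ≡⟨ ℤP.*-identityˡ _ ⟨
      1ℤ ℤ.* (sgn (dual f b) ℤ.* 2^m)                   ≡⟨ cong (ℤ._* (sgn (dual f b) ℤ.* 2^m)) sgn[d]*sgn[d]≡1 ⟨
      (sgn d ℤ.* sgn d) ℤ.* (sgn (dual f b) ℤ.* 2^m)    ≡⟨ solve 3 (λ s t p → (s :* s) :* (t :* p) := s :* (p :* (t :* s))) refl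
                                                             (sgn d) (sgn (dual f b)) 2^m ⟩
      sgn d ℤ.* (2^m ℤ.* (sgn (dual f b) ℤ.* sgn d))    ≡⟨ cong (λ i → sgn d ℤ.* (2^m ℤ.* i)) (sgn-xor (dual f b) d) ⟨
      sgn d ℤ.* (2^m ℤ.* sgn (dual f b xor d))          ∎
      where open +-*-Solver

    ∑walsh≡ : Int.∑ (walsh m F f) ≡ sgn d ℤ.* (2^m ℤ.* L)
    ∑walsh≡ = trans (Int.∑-cong walsh≡)
      (trans (sym (∑ℤ.*-distribˡ-sum (sgn d) (λ i → 2^m ℤ.* sgn (dual f (u i) xor d))))
             (cong (sgn d ℤ.*_) (sym (∑ℤ.*-distribˡ-sum 2^m (λ i → sgn (dual f (u i) xor d))))))

  -- An affine dual b ↦ dual f 0 ⊕ ℓ(b) would make ∑_b (−1)^{ℓ(b)} ∈ {0, q} equal to ±q/2^m.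
  dual-not-affine : ∀ {f} → IsBent m F f →
                    ∃[ b ] ∃[ b′ ] (dual f 0# xor dual f b) xor (dual f b′ xor dual f (b + b′)) ≡ true
  dual-not-affine {f} f-bent with search₂ (λ b b′ → (dual f 0# xor dual f b) xor (dual f b′ xor dual f (b + b′)))
  ... | inj₁ found  = found
  ... | inj₂ affine = ⊥-elim (2^m*∣i∣≢q (∑sgn-additive ℓ ℓ-+) (2^m*∣∑sgn[dual⊕d]∣≡q {f} f-bent (dual f 0#)))
    where
    ℓ : Carrier → Bool
    ℓ b = dual f b xor dual f 0#

    ℓ-+ : ∀ x y → ℓ (x + y) ≡ ℓ x xor ℓ y
    ℓ-+ x y = trans
      (solve 4 (λ d₀ dx dy dxy → dxy :+ d₀ := ((dx :+ d₀) :+ (dy :+ d₀)) :+ ((d₀ :+ dx) :+ (dy :+ dxy))) refl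
        (dual f 0#) (dual f x) (dual f y) (dual f (x + y)))
      (trans (cong ((ℓ x xor ℓ y) xor_) (affine x y)) (BoolP.xor-identityʳ _))
      where open BoolSolver

-- The codes C(f₁,…,f_s)

module BentCode (m : ℕ) (F : GF m) {s : ℕ} (fs : Fin s → BoolFun m F) where
  open WalshAnalysis m F

  Nonzero : (Fin s → Bool) → Set
  Nonzero a = ¬ (∀ j → a j ≡ false)

  _⊻_ : (Fin s → Bool) → (Fin s → Bool) → Fin s → Bool
  (a ⊻ a′) j = a j xor a′ j

  codeword : Carrier → Bool → (Fin s → Bool) → BoolFun m F
  codeword b c a x = (trᵇ (b * x) xor c) xor combo m F a fs x

  C-generator≡truthTable : ∀ b c a →
    tabulate (λ i → lookup (rmWord m F b c) i xor combo m F a fs (u i)) ≡ truthTable m F (codeword b c a)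
  C-generator≡truthTable b c a = tabulate-cong λ i → cong (_xor combo m F a fs (u i)) (lookup∘tabulate _ i)

  codeword∈C : ∀ b c a → C m F fs (truthTable m F (codeword b c a))
  codeword∈C b c a = b , c , a , sym (C-generator≡truthTable b c a)

  codeword-0 : ∀ a → (∀ j → a j ≡ false) → ∀ x → codeword 0# false a x ≡ false
  codeword-0 a a≡0 x = cong₂ (λ t k → (t xor false) xor k) (trans (cong trᵇ (zeroˡ x)) trᵇ-0) (combo-0 m F a fs x a≡0)

  codeword-⊕ : ∀ b c a b′ c′ a′ x →
    codeword b c a x xor codeword b′ c′ a′ x ≡ codeword (b + b′) (c xor c′) (a ⊻ a′) x
  codeword-⊕ b c a b′ c′ a′ x = begin
    ((t xor c) xor k) xor ((t′ xor c′) xor k′)   ≡⟨ solve 6 (λ t c k t′ c′ k′ → ((t :+ c) :+ k) :+ ((t′ :+ c′) :+ k′)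
                                                    := ((t :+ t′) :+ (c :+ c′)) :+ (k :+ k′)) refl t c k t′ c′ k′ ⟩
    ((t xor t′) xor (c xor c′)) xor (k xor k′)   ≡⟨ cong₂ (λ t″ k″ → (t″ xor (c xor c′)) xor k″)
                                                    (trans (sym (trᵇ-+ (b * x) (b′ * x))) (cong trᵇ (sym (distribʳ x b b′))))
                                                    (sym (combo-xor m F a a′ fs x)) ⟩
    codeword (b + b′) (c xor c′) (a ⊻ a′) x      ∎
    where
    open ≡-Reasoning
    open BoolSolver
    t  = trᵇ (b * x)
    t′ = trᵇ (b′ * x)
    k  = combo m F a fs x
    k′ = combo m F a′ fs x

  C-isLinear : IsLinear (C m F fs)
  C-isLinear = record
    { ∅∈C      = 0# , false , (λ _ → false) , sym (begin
        _                                                ≡⟨ C-generator≡truthTable 0# false _ ⟩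
        truthTable m F (codeword 0# false (λ _ → false)) ≡⟨ truthTable-cong (codeword-0 _ λ _ → refl) ⟩
        truthTable m F (λ _ → false)                     ≡⟨ truthTable-false ⟩
        ∅                                                ∎)
    ; ⊕-closed = λ { (b , c , a , refl) (b′ , c′ , a′ , refl) → b + b′ , c xor c′ , a ⊻ a′ , (begin
        _ ⊕ _                                                                ≡⟨ cong₂ _⊕_ (C-generator≡truthTable b c a)
                                                                                            (C-generator≡truthTable b′ c′ a′) ⟩
        truthTable m F (codeword b c a) ⊕ truthTable m F (codeword b′ c′ a′)  ≡⟨ truthTable-⊕ (codeword b c a) (codeword b′ c′ a′) ⟩
        truthTable m F (λ x → codeword b c a x xor codeword b′ c′ a′ x)      ≡⟨ truthTable-cong (codeword-⊕ b c a b′ c′ a′) ⟩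
        truthTable m F (codeword (b + b′) (c xor c′) (a ⊻ a′))               ≡⟨ C-generator≡truthTable (b + b′) (c xor c′) (a ⊻ a′) ⟨
        _                                                                    ∎) }
    }
    where open ≡-Reasoning

  signedSum-codeword : ∀ b c a → signedSum (truthTable m F (codeword b c a)) ≡ sgn c ℤ.* walsh m F (combo m F a fs) b
  signedSum-codeword b c a = begin
    signedSum (truthTable m F (codeword b c a))                    ≡⟨ signedSum-truthTable (codeword b c a) ⟩
    Int.∑ (sgn ∘ codeword b c a)                                   ≡⟨ Int.∑-cong (cong sgn ∘ rearrange) ⟩
    Int.∑ (λ x → sgn (c xor (combo m F a fs x xor trᵇ (b * x))))   ≡⟨ ∑sgn-scale c (λ x → combo m F a fs x xor trᵇ (b * x)) ⟩
    sgn c ℤ.* Int.∑ (λ x → sgn (combo m F a fs x xor trᵇ (b * x))) ≡⟨ cong (sgn c ℤ.*_) (walsh≡∑ (combo m F a fs) b) ⟨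
    sgn c ℤ.* walsh m F (combo m F a fs) b                         ∎
    where
    open ≡-Reasoning
    rearrange : ∀ x → codeword b c a x ≡ c xor (combo m F a fs x xor trᵇ (b * x))
    rearrange x = solve 3 (λ t c k → (t :+ c) :+ k := c :+ (k :+ t)) refl (trᵇ (b * x)) c (combo m F a fs x)
      where open BoolSolver

  signedSum-affine≤0 : ∀ b c a → (∀ j → a j ≡ false) → truthTable m F (codeword b c a) ≢ ∅ →
                       signedSum (truthTable m F (codeword b c a)) ℤ.≤ 0ℤ
  signedSum-affine≤0 b c a a≡0 w≢∅ = ℤP.≤-trans
    (ℤP.≤-reflexive (trans (signedSum-codeword b c a) (cong (sgn c ℤ.*_) walsh≡character-sum)))
    (bound c w≢∅ (b ≟ 0#))
    where
    walsh≡character-sum : walsh m F (combo m F a fs) b ≡ Int.∑ (λ x → sgn (trᵇ (b * x)))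
    walsh≡character-sum = trans (walsh≡∑ (combo m F a fs) b)
      (Int.∑-cong λ x → cong (λ k → sgn (k xor trᵇ (b * x))) (combo-0 m F a fs x a≡0))

    bound : ∀ c → truthTable m F (codeword b c a) ≢ ∅ → Dec (b ≡ 0#) →
            sgn c ℤ.* Int.∑ (λ x → sgn (trᵇ (b * x))) ℤ.≤ 0ℤ
    bound c     _   (no b≢0)   = ℤP.≤-reflexive (trans (cong (sgn c ℤ.*_) (character-sum-≢0 b≢0)) (ℤP.*-zeroʳ (sgn c)))
    bound true  _   (yes refl) = ℤP.≤-trans (ℤP.≤-reflexive (trans (cong (-1ℤ ℤ.*_) character-sum-0) (ℤP.-1*i≡-i _))) ℤP.neg-≤-pos
    bound false w≢∅ (yes refl) = ⊥-elim (w≢∅ (trans (truthTable-cong (codeword-0 a a≡0)) truthTable-false))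

  module _ (bent : IsBentVectorial m F fs) where

    signedSum≤2^m : ∀ {w} → C m F fs w → w ≢ ∅ → signedSum w ℤ.≤ ℤ.+ (2 ℕ.^ m)
    signedSum≤2^m (b , c , a , refl) w≢∅ rewrite C-generator≡truthTable b c a with FinP.all? (λ j → a j Data.Bool.≟ false)
    ... | yes a≡0 = ℤP.≤-trans (signedSum-affine≤0 b c a a≡0 w≢∅) (ℤ.+≤+ ℕ.z≤n)
    ... | no a≢0  = begin
      signedSum (truthTable m F (codeword b c a))       ≡⟨ signedSum-codeword b c a ⟩
      sgn c ℤ.* walsh m F (combo m F a fs) b            ≤⟨ i≤+∣i∣ _ ⟩
      ℤ.+ ℤ.∣ sgn c ℤ.* walsh m F (combo m F a fs) b ∣  ≡⟨ cong ℤ.+_ (trans (∣sgn*i∣ c _) (bent a a≢0 b)) ⟩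
      ℤ.+ (2 ℕ.^ m)                                     ∎
      where open ℤP.≤-Reasoning

    block : (Fin s → Bool) → Carrier → BoolFun m F
    block a b = codeword b (dual (combo m F a fs) b) a

    signedSum-block : ∀ {a} → Nonzero a → ∀ b → signedSum (truthTable m F (block a b)) ≡ ℤ.+ (2 ℕ.^ m)
    signedSum-block {a} a≢0 b = trans (signedSum-codeword b _ a)
      (trans (sgn[signBit]*i≡∣i∣ (walsh m F (combo m F a fs) b)) (cong ℤ.+_ (bent a a≢0 b)))

    block-minimal : ∀ {a} → Nonzero a → ∀ b → IsMinWeightWord (C m F fs) (truthTable m F (block a b))
    block-minimal {a} a≢0 b = codeword∈C b _ a , block≢∅ , λ v v∈C v≢∅ → signedSum≤⇒∣∣≥ v (truthTable m F (block a b))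
      (ℤP.≤-trans (signedSum≤2^m v∈C v≢∅) (ℤP.≤-reflexive (sym (signedSum-block a≢0 b))))
      where
      block≢∅ : truthTable m F (block a b) ≢ ∅
      block≢∅ block≡∅ = ℕP.<⇒≢ 2^m<q (ℤP.+-injective (begin
        ℤ.+ (2 ℕ.^ m)                             ≡⟨ signedSum-block a≢0 b ⟨
        signedSum (truthTable m F (block a b))    ≡⟨ cong signedSum (trans block≡∅ (sym truthTable-false)) ⟩
        signedSum (truthTable m F (λ _ → false))  ≡⟨ signedSum-truthTable _ ⟩
        Int.∑ (λ _ → sgn false)                   ≡⟨ ∑sgn-false ⟩
        ℤ.+ q m F                                 ∎))
        where open ≡-Reasoning

    record Spanned (f : BoolFun m F) : Set where
      constructor spanned
      field span : Span (IsMinWeightWord (C m F fs)) (truthTable m F f)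

    Spanned-xor : ∀ {f g} → Spanned f → Spanned g → Spanned (λ x → f x xor g x)
    Spanned-xor {f} {g} (spanned f∈) (spanned g∈) = spanned (subst (Span _) (truthTable-⊕ f g) (Span-⊕ f∈ g∈))

    Spanned-cong : ∀ {f g} → (∀ x → f x ≡ g x) → Spanned f → Spanned g
    Spanned-cong f≗g (spanned f∈) = spanned (subst (Span _) (truthTable-cong f≗g) f∈)

    Spanned-block : ∀ {a} → Nonzero a → ∀ b → Spanned (block a b)
    Spanned-block a≢0 b = spanned (P⊆Span (block-minimal a≢0 b))

    module _ (j₀ : Fin s) where
      private
        a₀ : Fin s → Bool
        a₀ _ = true

        a₀≢0 : Nonzero a₀
        a₀≢0 a₀≡0 with a₀≡0 j₀
        ... | ()

        f₀ = combo m F a₀ fs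
        σ  = dual f₀

      Spanned-const : ∀ d → Spanned (λ _ → d)
      Spanned-const false = spanned (subst (Span _) (sym truthTable-false) ∅∈Span)
      Spanned-const true with dual-not-affine {f₀} (bent a₀ a₀≢0)
      ... | b , b′ , σ-sum≡true = Spanned-cong sum≡true
            (Spanned-xor (Spanned-xor (Spanned-block a₀≢0 0#) (Spanned-block a₀≢0 b))
                         (Spanned-xor (Spanned-block a₀≢0 b′) (Spanned-block a₀≢0 (b + b′))))
        where
        sum≡true : ∀ x → (block a₀ 0# x xor block a₀ b x) xor (block a₀ b′ x xor block a₀ (b + b′) x) ≡ true
        sum≡true x = begin
          (((trᵇ (0# * x) xor σ 0#) xor f₀ x) xor ((trᵇ (b * x) xor σ b) xor f₀ x))
            xor (((trᵇ (b′ * x) xor σ b′) xor f₀ x) xor ((trᵇ ((b + b′) * x) xor σ (b + b′)) xor f₀ x))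
                 ≡⟨ cong₂ (λ t₀ t → (((t₀ xor σ 0#) xor f₀ x) xor ((trᵇ (b * x) xor σ b) xor f₀ x))
                                      xor (((trᵇ (b′ * x) xor σ b′) xor f₀ x) xor ((t xor σ (b + b′)) xor f₀ x)))
                      (trans (cong trᵇ (zeroˡ x)) trᵇ-0) (trans (cong trᵇ (distribʳ x b b′)) (trᵇ-+ (b * x) (b′ * x))) ⟩
          (((false xor σ 0#) xor f₀ x) xor ((trᵇ (b * x) xor σ b) xor f₀ x))
            xor (((trᵇ (b′ * x) xor σ b′) xor f₀ x) xor (((trᵇ (b * x) xor trᵇ (b′ * x)) xor σ (b + b′)) xor f₀ x))
                 ≡⟨ solve 7 (λ s₀ sb sb′ sbb t t′ f → (((con false :+ s₀) :+ f) :+ ((t :+ sb) :+ f))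
                                                      :+ (((t′ :+ sb′) :+ f) :+ (((t :+ t′) :+ sbb) :+ f))
                                                   := (s₀ :+ sb) :+ (sb′ :+ sbb))
                      refl (σ 0#) (σ b) (σ b′) (σ (b + b′)) (trᵇ (b * x)) (trᵇ (b′ * x)) (f₀ x) ⟩
          (σ 0# xor σ b) xor (σ b′ xor σ (b + b′))
                 ≡⟨ σ-sum≡true ⟩
          true   ∎
          where
          open ≡-Reasoning
          open BoolSolver

      Spanned-codeword : ∀ b c a → Spanned (codeword b c a)
      Spanned-codeword b c a with FinP.all? (λ j → a j Data.Bool.≟ false)
      ... | no a≢0 = Spanned-cong rearrange (Spanned-xor (Spanned-block a≢0 b) (Spanned-const (σₐ xor c)))
        where
        σₐ = dual (combo m F a fs) b
        rearrange : ∀ x → block a b x xor (σₐ xor c) ≡ codeword b c a x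
        rearrange x = solve 4 (λ t σ c k → ((t :+ σ) :+ k) :+ (σ :+ c) := (t :+ c) :+ k) refl (trᵇ (b * x)) σₐ c (combo m F a fs x)
          where open BoolSolver
      ... | yes a≡0 = Spanned-cong rearrange
                        (Spanned-xor (Spanned-xor (Spanned-block a₀≢0 b) (Spanned-block a₀≢0 0#)) (Spanned-const ((σ b xor σ 0#) xor c)))
        where
        rearrange : ∀ x → (block a₀ b x xor block a₀ 0# x) xor ((σ b xor σ 0#) xor c) ≡ codeword b c a x
        rearrange x = begin
          (((trᵇ (b * x) xor σ b) xor f₀ x) xor ((trᵇ (0# * x) xor σ 0#) xor f₀ x)) xor ((σ b xor σ 0#) xor c)
                 ≡⟨ cong (λ t₀ → (((trᵇ (b * x) xor σ b) xor f₀ x) xor ((t₀ xor σ 0#) xor f₀ x)) xor ((σ b xor σ 0#) xor c))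
                      (trans (cong trᵇ (zeroˡ x)) trᵇ-0) ⟩
          (((trᵇ (b * x) xor σ b) xor f₀ x) xor ((false xor σ 0#) xor f₀ x)) xor ((σ b xor σ 0#) xor c)
                 ≡⟨ solve 5 (λ t sb s₀ f c → (((t :+ sb) :+ f) :+ ((con false :+ s₀) :+ f)) :+ ((sb :+ s₀) :+ c)
                                          := (t :+ c) :+ con false)
                      refl (trᵇ (b * x)) (σ b) (σ 0#) (f₀ x) c ⟩
          (trᵇ (b * x) xor c) xor false
                 ≡⟨ cong ((trᵇ (b * x) xor c) xor_) (combo-0 m F a fs x a≡0) ⟨
          codeword b c a x ∎
          where
          open ≡-Reasoning
          open BoolSolver

      C-spanned : SpannedByMinWeightWords (C m F fs)
      C-spanned (b , c , a , refl) = subst (Span _) (sym (C-generator≡truthTable b c a)) (Spanned.span (Spanned-codeword b c a))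

corollary14 : (m : ℕ) → 2 ≤ m → (s : ℕ) → 1 ≤ s → s ≤ m →
    (F : GF m) → (fs gs : Fin s → BoolFun m F) →
    IsBentVectorial m F fs → IsBentVectorial m F gs →
    CodesEquivalent (C m F fs) (C m F gs) ⇔ DesignsIsomorphic (C m F fs) (C m F gs)
corollary14 m _ s 1≤s _ F fs gs fs-bent gs-bent =
  mk⇔ equivalent⇒isomorphic
      (isomorphic⇒equivalent (BentCode.C-isLinear m F fs) (BentCode.C-isLinear m F gs)
                             (BentCode.C-spanned m F fs fs-bent j₀) (BentCode.C-spanned m F gs gs-bent j₀))
  where
  j₀ : Fin s
  j₀ = Fin.fromℕ< 1≤s
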